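{- For every positive integer $n$, the game value of the path position $P_n$ in the Forbidden Leaf Variant of the Mixed Deletion Game is not a positive integer and is not a positive dyadic rational.
   Context: The Classic Variant of the Mixed Deletion Game is a two-player combinatorial game between Left and Right played on a finite simple undirected graph; players alternate turns. On her turn Left deletes one vertex together with all edges incident to it; on his turn Right deletes one edge. The game ends when a deletion creates an isolated vertex (a vertex of degree $0$), and the player whose deletion created an isolated vertex loses; thus a legal move is a deletion which does not create an isolated vertex, and a player with no legal move loses (normal play). The Forbidden Leaf Variant has the same rules with the additional restriction that Left may not delete a leaf (a vertex of degree $1$). A disconnected graph position is the disjunctive sum of the games on its components, and game values are taken in the usual sense of combinatorial game theory (Conway values). $P_n$ denotes the path graph on $n$ vertices. -}

module Defs where

open import Data.Nat using (ℕ; zero; suc; _+_; _*_; _≡ᵇ_; _<_)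
open import Data.Nat.Base using (_/_)
open import Data.Bool using (Bool; true; false; _∧_; _∨_; not; if_then_else_)
open import Data.List using (List; []; _∷_; map; filterᵇ; length; upTo)
open import Data.Bool.ListAction using (any)
open import Data.Product using (_×_; _,_)
open import Data.Nat.Base using (_%_)

data Game : Set where
  ⟨_∣_⟩ : List Game → List Game → Game

mutual
  leᵇ : Game → Game → Bool
  leᵇ ⟨ GL ∣ GR ⟩ ⟨ HL ∣ HR ⟩ = noLeftAbove GL ⟨ HL ∣ HR ⟩ ∧ noRightBelow ⟨ GL ∣ GR ⟩ HR

  noLeftAbove : List Game → Game → Bool
  noLeftAbove []       H = true
  noLeftAbove (g ∷ gs) H = not (leᵇ H g) ∧ noLeftAbove gs H

  noRightBelow : Game → List Game → Bool
  noRightBelow G []       = true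
  noRightBelow G (h ∷ hs) = not (leᵇ h G) ∧ noRightBelow G hs

_≤G_ : Game → Game → Set
G ≤G H = leᵇ G H ≡ true
  where open import Relation.Binary.PropositionalEquality using (_≡_)

_≈G_ : Game → Game → Set
G ≈G H = (G ≤G H) × (H ≤G G)

intGame : ℕ → Game
intGame zero    = ⟨ [] ∣ [] ⟩
intGame (suc n) = ⟨ intGame n ∷ [] ∣ [] ⟩

-- the dyadic rational m / 2^k  (m ≥ 0):
--   m / 2^0 = m ;  for even m, m/2^(k+1) = (m/2)/2^k ;
--   for odd m = 2a+1,  m/2^(k+1) = { a/2^k | (a+1)/2^k }.
dyadicGame : ℕ → ℕ → Game
dyadicGame m zero    = intGame m
dyadicGame m (suc k) =
  if (m % 2) ≡ᵇ 0
  then dyadicGame (m / 2) k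
  else ⟨ dyadicGame (m / 2) k ∷ [] ∣ dyadicGame (suc (m / 2)) k ∷ [] ⟩

record Graph : Set where
  constructor graph
  field
    vertices : List ℕ
    edges    : List (ℕ × ℕ)
open Graph public

incident : ℕ → ℕ × ℕ → Bool
incident v (a , b) = (v ≡ᵇ a) ∨ (v ≡ᵇ b)

sameEdge : ℕ × ℕ → ℕ × ℕ → Bool
sameEdge (a , b) (c , d) = (a ≡ᵇ c) ∧ (b ≡ᵇ d)

degree : Graph → ℕ → ℕ
degree G v = length (filterᵇ (incident v) (edges G))

isLeaf : Graph → ℕ → Bool
isLeaf G v = degree G v ≡ᵇ 1

hasIsolated : Graph → Bool
hasIsolated G = any (λ v → degree G v ≡ᵇ 0) (vertices G)

deleteVertex : Graph → ℕ → Graph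
deleteVertex G v =
  graph (filterᵇ (λ u → not (u ≡ᵇ v)) (vertices G))
        (filterᵇ (λ e → not (incident v e)) (edges G))

deleteEdge : Graph → ℕ × ℕ → Graph
deleteEdge G e = graph (vertices G) (filterᵇ (λ f → not (sameEdge e f)) (edges G))

-- A position containing an isolated vertex is one in which the game has
-- ended: no moves.  Otherwise a legal move is a deletion that does not
-- create an isolated vertex; Left (vertex deletion) may not delete a leaf.
leftMoves : Graph → List Graph
leftMoves G =
  if hasIsolated G then []
  else filterᵇ (λ H → not (hasIsolated H))
         (map (deleteVertex G) (filterᵇ (λ v → not (isLeaf G v)) (vertices G)))

rightMoves : Graph → List Graph
rightMoves G =
  if hasIsolated G then []
  else filterᵇ (λ H → not (hasIsolated H)) (map (deleteEdge G) (edges G))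

-- game tree, built with fuel (each move strictly decreases
-- #vertices + #edges, so fuel = #vertices + #edges + 1 suffices)
gameWithFuel : ℕ → Graph → Game
gameWithFuel zero    G = ⟨ [] ∣ [] ⟩
gameWithFuel (suc f) G = ⟨ map (gameWithFuel f) (leftMoves G) ∣ map (gameWithFuel f) (rightMoves G) ⟩

forbiddenLeafGame : Graph → Game
forbiddenLeafGame G = gameWithFuel (suc (length (vertices G) + length (edges G))) G

pathEdges : ℕ → List (ℕ × ℕ)
pathEdges zero          = []
pathEdges (suc zero)    = []
pathEdges (suc (suc n)) = map (λ i → i , suc i) (upTo (suc n))

path : ℕ → Graph
path n = graph (upTo n) (pathEdges n)

-- For n ≤ 3 the path P_n admits no legal move, so its value is 0.  For n ≥ 4 we show that
-- P_n has a right option G ≤ 0, so that no positive number D satisfies D ≤ P_n.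
-- Positions are disjoint unions of paths.  A legal Left move deletes a vertex with at least
-- two vertices on each side, splitting a path into two paths with at least two vertices.
-- Right keeps the potential, the sum of weight (number of vertices) over the paths,
-- nonnegative: he cuts a P₂ or a P₄ off one of the two pieces, or some P₄ elsewhere into two
-- P₂'s.  That one of these answers always works is a finite check, weight being 2-periodic
-- from 7 on.  Hence every position of nonnegative potential with Left to move is ≤ 0.

module Submission where

open import Defs
open import Data.Bool using (Bool; true; false; _∧_; _∨_; not; T)
open import Data.Bool.ListAction using (any)
open import Data.Bool.Properties using (∧-zeroʳ; ∨-assoc; ∨-comm; T-∨; T-∧; T?)
open import Data.Empty using (⊥-elim)
open import Data.Fin using (Fin; toℕ; fromℕ<)
open import Data.Fin.Properties using (all?; toℕ-fromℕ<)
open import Data.Integer as ℤ using (ℤ; 0ℤ; 1ℤ; -1ℤ; -≤+)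
import Data.Integer.Properties as ℤ
open import Data.Integer.Tactic.RingSolver using (solve-∀)
open import Data.List using (List; []; _∷_; _++_; map; length; filterᵇ; applyUpTo; upTo)
open import Data.List.Membership.Propositional using (_∈_; lose)
open import Data.List.Membership.Propositional.Properties using (∈-++⁺ˡ; ∈-++⁺ʳ; ∈-map⁺; ∈-filter⁺)
open import Data.List.Properties
  using (++-assoc; ++-identityʳ; map-++; length-++; length-map; length-upTo; filter-++; filter-all; filter-none)
open import Data.List.Relation.Unary.All as All using (All; []; _∷_)
import Data.List.Relation.Unary.All.Properties as All
open import Data.List.Relation.Unary.All.Properties using (All¬⇒¬Any)
open import Data.List.Relation.Unary.Any as Any using (Any; here; there)
import Data.List.Relation.Unary.Any.Properties as Any
open import Data.List.Relation.Unary.Any.Properties using (any⁺; any⁻)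
import Data.Nat as ℕ
open import Data.Nat using (ℕ; zero; suc; pred; _+_; _∸_; _⊓_; _≤_; _<_; _≡ᵇ_; _%_; _/_; s≤s; z≤n)
open import Data.Nat.DivMod using (m≥n⇒m/n>0)
open import Data.Nat.Induction using (<-rec)
open import Data.Nat.Properties
  using ( ≡ᵇ⇒≡; ≡⇒≡ᵇ; ≤ᵇ⇒≤; <⇒≢; >⇒≢; ≮⇒≥
        ; ≤-refl; ≤-reflexive; ≤-trans; <-≤-trans; ≤-pred
        ; n≤1+n; n<1+n; m≤m+n; m≤n+m; m<m+n; m≤n⇒m≤1+n; m<n⇒m<1+n; m≤n⇒∃[o]m+o≡n
        ; +-identityʳ; +-suc; +-comm; +-assoc; +-mono-≤; +-monoʳ-<; m+n∸m≡n; m+n≡0⇒m≡0; m+n≡0⇒n≡0)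
open import Data.Product as Product using (Σ; _×_; _,_; proj₁; proj₂)
open import Data.Sum using (inj₁; inj₂; [_,_])
open import Data.Unit using (⊤)
open import Function using (_∘_; Equivalence)
open import Relation.Binary.PropositionalEquality
  using (_≡_; _≢_; refl; sym; trans; cong; cong₂; subst; subst₂; module ≡-Reasoning)
open import Relation.Nullary using (¬_; Dec; yes; no)
open import Relation.Nullary.Decidable using (from-yes)

open ≡-Reasoning

∧-true-left : ∀ {x y} → x ∧ y ≡ true → x ≡ true
∧-true-left {true} _ = refl

∧-true-right : ∀ {x y} → x ∧ y ≡ true → y ≡ true
∧-true-right {true} p = p

T-not : ∀ {b} → ¬ T b → T (not b)
T-not {false} _ = _
T-not {true} ¬b = ¬b _

T-not⇒¬T : ∀ {b} → T (not b) → ¬ T b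
T-not⇒¬T {false} _ ()

T⇒¬T-not : ∀ {b} → T b → ¬ T (not b)
T⇒¬T-not {true} _ ()

¬T⇒≡false : ∀ {b} → ¬ T b → b ≡ false
¬T⇒≡false {false} _ = refl
¬T⇒≡false {true} ¬b = ⊥-elim (¬b _)

≢⇒¬T≡ᵇ : ∀ {m n} → m ≢ n → ¬ T (m ≡ᵇ n)
≢⇒¬T≡ᵇ {m} {n} m≢n = m≢n ∘ ≡ᵇ⇒≡ m n

¬T-any : ∀ {A : Set} (p : A → Bool) xs → All (λ x → ¬ T (p x)) xs → ¬ T (any p xs)
¬T-any p xs none = All¬⇒¬Any none ∘ any⁻ p xs

All-filterᵇ : ∀ {A : Set} {P : A → Set} (p : A → Bool) {xs} →
  All (λ x → T (p x) → P x) xs → All P (filterᵇ p xs)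
All-filterᵇ p {xs} h =
  All.zipWith (λ (f , px) → f px) (All.filter⁺ (T? ∘ p) h , All.all-filter (T? ∘ p) xs)

-- Games below every nonnegative game

leftOptions rightOptions : Game → List Game
leftOptions  ⟨ L ∣ _ ⟩ = L
rightOptions ⟨ _ ∣ R ⟩ = R

-- An inductive characterisation of 0 ≤ D.
data NonNeg : Game → Set where
  nonNeg : ∀ {L R} → All (λ r → Any NonNeg (leftOptions r)) R → NonNeg ⟨ L ∣ R ⟩

AtMostNonNeg : Game → Set
AtMostNonNeg X = ∀ D → NonNeg D → X ≤G D

HasNonNegLeftOption : Game → Set
HasNonNegLeftOption D = Any NonNeg (leftOptions D)

noLeftAbove-false : ∀ gs H → Any (λ g → H ≤G g) gs → noLeftAbove gs H ≡ false
noLeftAbove-false (g ∷ gs) H (here H≤g) rewrite H≤g = refl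
noLeftAbove-false (g ∷ gs) H (there p) rewrite noLeftAbove-false gs H p = ∧-zeroʳ _

noRightBelow-false : ∀ G hs → Any (λ h → h ≤G G) hs → noRightBelow G hs ≡ false
noRightBelow-false G (h ∷ hs) (here h≤G) rewrite h≤G = refl
noRightBelow-false G (h ∷ hs) (there p) rewrite noRightBelow-false G hs p = ∧-zeroʳ _

below-nonNeg : ∀ {D} → NonNeg D → ∀ {hs} → Any AtMostNonNeg hs → Any (λ h → h ≤G D) hs
below-nonNeg d = Any.map (λ x → x _ d)

-- X ≤ D can only fail through D ≤ X^L, excluded by a right option of X^L below D,
-- or through D^R ≤ X, excluded since D^R has a left option D^RL ≥ 0 with X ≤ D^RL.
module _ {XL XR : List Game}
         (answered : All (λ l → Any AtMostNonNeg (rightOptions l)) XL) where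
  mutual
    atMostNonNeg-intro : AtMostNonNeg ⟨ XL ∣ XR ⟩
    atMostNonNeg-intro ⟨ DL ∣ DR ⟩ (nonNeg ps)
      rewrite noLeftAbove-true XL answered ⟨ DL ∣ DR ⟩ (nonNeg ps) = noRightBelow-true DR ps

    private
      noLeftAbove-true : ∀ ls → All (λ l → Any AtMostNonNeg (rightOptions l)) ls →
                         ∀ D → NonNeg D → noLeftAbove ls D ≡ true
      noLeftAbove-true [] [] D d = refl
      noLeftAbove-true (⟨ lL ∣ lR ⟩ ∷ ls) (a ∷ as) ⟨ DL ∣ DR ⟩ d
        rewrite noRightBelow-false ⟨ DL ∣ DR ⟩ lR (below-nonNeg d a)
              | ∧-zeroʳ (noLeftAbove DL ⟨ lL ∣ lR ⟩) = noLeftAbove-true ls as ⟨ DL ∣ DR ⟩ d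

      noRightBelow-true : ∀ DR → All (λ r → Any NonNeg (leftOptions r)) DR →
                          noRightBelow ⟨ XL ∣ XR ⟩ DR ≡ true
      noRightBelow-true [] [] = refl
      noRightBelow-true (⟨ rL ∣ rR ⟩ ∷ DR) (a ∷ as)
        rewrite noLeftAbove-false rL ⟨ XL ∣ XR ⟩ (above a) = noRightBelow-true DR as

      above : ∀ {gs} → Any NonNeg gs → Any (λ g → ⟨ XL ∣ XR ⟩ ≤G g) gs
      above {g ∷ _} (here d) = here (atMostNonNeg-intro g d)
      above (there p) = there (above p)

zero-atMostNonNeg : AtMostNonNeg ⟨ [] ∣ [] ⟩
zero-atMostNonNeg = atMostNonNeg-intro []

≰-of-rightOption : ∀ {D GL GR} → NonNeg D → Any AtMostNonNeg GR → ¬ (D ≤G ⟨ GL ∣ GR ⟩)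
≰-of-rightOption {⟨ DL ∣ DR ⟩} {GL} {GR} d a D≤G
  with () ← trans (sym (∧-true-right D≤G)) (noRightBelow-false ⟨ DL ∣ DR ⟩ GR (below-nonNeg d a))

≰-zero : ∀ {D} → HasNonNegLeftOption D → ¬ (D ≤G ⟨ [] ∣ [] ⟩)
≰-zero {⟨ DL ∣ DR ⟩} p D≤0
  with () ← trans (sym (∧-true-left D≤0))
                  (noLeftAbove-false DL ⟨ [] ∣ [] ⟩ (Any.map (zero-atMostNonNeg _) p))

nonNeg-intGame : ∀ m → NonNeg (intGame m)
nonNeg-intGame zero = nonNeg []
nonNeg-intGame (suc m) = nonNeg []

hasNonNegLeftOption-intGame : ∀ m → HasNonNegLeftOption (intGame (suc m))
hasNonNegLeftOption-intGame m = here (nonNeg-intGame m)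

mutual
  nonNeg-dyadicGame : ∀ m k → NonNeg (dyadicGame m k)
  nonNeg-dyadicGame m zero = nonNeg-intGame m
  nonNeg-dyadicGame m (suc k) with (m % 2) ≡ᵇ 0
  ... | true  = nonNeg-dyadicGame (m / 2) k
  ... | false = nonNeg (hasNonNegLeftOption-dyadicGame (suc (m / 2)) k (s≤s z≤n) ∷ [])

  hasNonNegLeftOption-dyadicGame : ∀ m k → 0 < m → HasNonNegLeftOption (dyadicGame m k)
  hasNonNegLeftOption-dyadicGame (suc m) zero _ = hasNonNegLeftOption-intGame m
  hasNonNegLeftOption-dyadicGame (suc zero) (suc k) _ = here (nonNeg-dyadicGame 0 k)
  hasNonNegLeftOption-dyadicGame (suc (suc m)) (suc k) _ with (m % 2) ≡ᵇ 0
  ... | true  = hasNonNegLeftOption-dyadicGame (suc (suc m) / 2) k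
                  (m≥n⇒m/n>0 {suc (suc m)} {2} (s≤s (s≤s z≤n)))
  ... | false = here (nonNeg-dyadicGame (suc (suc m) / 2) k)

¬incident : ∀ {v a b} → a ≢ v → b ≢ v → ¬ T (incident v (a , b))
¬incident a≢v b≢v v∼ab =
  [ ≢⇒¬T≡ᵇ (a≢v ∘ sym) , ≢⇒¬T≡ᵇ (b≢v ∘ sym) ] (Equivalence.to T-∨ v∼ab)

link : ℕ → ℕ × ℕ
link i = i , suc i

_⊕_ : Graph → Graph → Graph
G ⊕ H = graph (vertices G ++ vertices H) (edges G ++ edges H)

infixr 5 _⊕_

⊕-assoc : ∀ G H K → (G ⊕ H) ⊕ K ≡ G ⊕ (H ⊕ K)
⊕-assoc G H K = cong₂ graph (++-assoc (vertices G) _ _) (++-assoc (edges G) _ _)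

deleteVertex-⊕ : ∀ G H v → deleteVertex (G ⊕ H) v ≡ deleteVertex G v ⊕ deleteVertex H v
deleteVertex-⊕ G H v = cong₂ graph (filter-++ _ (vertices G) _) (filter-++ _ (edges G) _)

deleteEdge-⊕ : ∀ G H e → deleteEdge (G ⊕ H) e ≡ deleteEdge G e ⊕ deleteEdge H e
deleteEdge-⊕ G H e = cong (graph _) (filter-++ _ (edges G) _)

degree-⊕ : ∀ G H v → degree (G ⊕ H) v ≡ degree G v + degree H v
degree-⊕ G H v =
  trans (cong length (filter-++ _ (edges G) _)) (length-++ (filterᵇ (incident v) (edges G)))

AllLabels : (ℕ → Set) → Graph → Set
AllLabels P G = All P (vertices G) × All (λ e → P (proj₁ e) × P (proj₂ e)) (edges G)

AllLabels-⊕ : ∀ {P G H} → AllLabels P G → AllLabels P H → AllLabels P (G ⊕ H)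
AllLabels-⊕ (pv , pe) (qv , qe) = All.++⁺ pv qv , All.++⁺ pe qe

AllLabels-map : ∀ {P Q G} → (∀ {x} → P x → Q x) → AllLabels P G → AllLabels Q G
AllLabels-map f (pv , pe) = All.map f pv , All.map (Product.map f f) pe

deleteVertex-avoid : ∀ {G v} → AllLabels (_≢ v) G → deleteVertex G v ≡ G
deleteVertex-avoid (pv , pe) =
  cong₂ graph (filter-all _ (All.map (T-not ∘ ≢⇒¬T≡ᵇ) pv))
              (filter-all _ (All.map (λ (a≢v , b≢v) → T-not (¬incident a≢v b≢v)) pe))

degree-avoid : ∀ {G v} → AllLabels (_≢ v) G → degree G v ≡ 0
degree-avoid (_ , pe) = cong length (filter-none _ (All.map (λ (a≢v , b≢v) → ¬incident a≢v b≢v) pe))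

deleteEdge-avoid : ∀ {G i} → All (λ e → proj₁ e ≢ i) (edges G) → deleteEdge G (link i) ≡ G
deleteEdge-avoid {i = i} pe =
  cong (graph _) (filter-all _ (All.map (λ {e} a≢i → T-not (a≢i ∘ sym ∘ sameEdge⇒≡ e)) pe))
  where
    sameEdge⇒≡ : ∀ e → T (sameEdge (link i) e) → i ≡ proj₁ e
    sameEdge⇒≡ (a , _) same = ≡ᵇ⇒≡ i a (proj₁ (Equivalence.to T-∧ same))

isolated-⊕ : ∀ G H v → T (degree (G ⊕ H) v ≡ᵇ 0) → T (degree G v ≡ᵇ 0) × T (degree H v ≡ᵇ 0)
isolated-⊕ G H v iso =
  ≡⇒≡ᵇ _ 0 (m+n≡0⇒m≡0 (degree G v) sum≡0) , ≡⇒≡ᵇ _ 0 (m+n≡0⇒n≡0 (degree G v) sum≡0)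
  where
    sum≡0 : degree G v + degree H v ≡ 0
    sum≡0 = trans (sym (degree-⊕ G H v)) (≡ᵇ⇒≡ _ 0 iso)

noIsolated-⊕ : ∀ {G H} → ¬ T (hasIsolated G) → ¬ T (hasIsolated H) → ¬ T (hasIsolated (G ⊕ H))
noIsolated-⊕ {G} {H} noG noH iso with Any.++⁻ (vertices G) (any⁻ _ _ iso)
... | inj₁ p = noG (any⁺ _ (Any.map (λ {v} → proj₁ ∘ isolated-⊕ G H v) p))
... | inj₂ p = noH (any⁺ _ (Any.map (λ {v} → proj₂ ∘ isolated-⊕ G H v) p))

All-leftMoves : ∀ (P : Graph → Set) G →
  All (λ v → T (not (isLeaf G v)) → T (not (hasIsolated (deleteVertex G v))) → P (deleteVertex G v))
      (vertices G) →
  All P (leftMoves G)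
All-leftMoves P G h with hasIsolated G
... | true  = []
... | false = All-filterᵇ (not ∘ hasIsolated) (All.map⁺ (All-filterᵇ (not ∘ isLeaf G) h))

Any-rightMoves : ∀ (P : Graph → Set) G e → ¬ T (hasIsolated G) → e ∈ edges G →
  ¬ T (hasIsolated (deleteEdge G e)) → P (deleteEdge G e) → Any P (rightMoves G)
Any-rightMoves P G e noIsolated e∈ legal p rewrite ¬T⇒≡false noIsolated =
  lose (∈-filter⁺ (T? ∘ (not ∘ hasIsolated)) (∈-map⁺ (deleteEdge G) e∈) (T-not legal)) p

-- Paths and linear forests

interval : ℕ → ℕ → List ℕ
interval s zero = []
interval s (suc l) = s ∷ interval (suc s) l

segment : ℕ → ℕ → Graph
segment s l = graph (interval s l) (map link (interval s (pred l)))

interval-++ : ∀ s a b → interval s (a + b) ≡ interval s a ++ interval (s + a) b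
interval-++ s zero b rewrite +-identityʳ s = refl
interval-++ s (suc a) b rewrite +-suc s a = cong (s ∷_) (interval-++ (suc s) a b)

interval-bounds : ∀ s l → All (λ x → s ≤ x × x < s + l) (interval s l)
interval-bounds s zero = []
interval-bounds s (suc l) rewrite +-suc s l =
  (≤-refl , s≤s (m≤m+n s l)) ∷ All.map (Product.map₁ (≤-trans (n≤1+n s))) (interval-bounds (suc s) l)

v<end : ∀ s t u → s + t < s + (t + suc u)
v<end s t u = +-monoʳ-< s (m<m+n t (s≤s z≤n))

interval-positions : ∀ s l →
  All (λ x → Σ ℕ λ t → Σ ℕ λ u → l ≡ t + suc u × x ≡ s + t) (interval s l)
interval-positions s zero = []
interval-positions s (suc l) =
  (0 , l , refl , sym (+-identityʳ s)) ∷
  All.map (λ (t , u , l≡ , x≡) → suc t , u , cong suc l≡ , trans x≡ (sym (+-suc s t)))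
          (interval-positions (suc s) l)

segment-labels : ∀ s l → AllLabels (λ x → s ≤ x × x < s + l) (segment s l)
segment-labels s zero = [] , []
segment-labels s (suc l) = interval-bounds s (suc l) , All.map⁺ (All.map endpoints (interval-bounds s l))
  where
    endpoints : ∀ {i} → s ≤ i × i < s + l →
                (s ≤ i × i < s + suc l) × (s ≤ suc i × suc i < s + suc l)
    endpoints (s≤i , i<) rewrite +-suc s l = (s≤i , m<n⇒m<1+n i<) , (m≤n⇒m≤1+n s≤i , s≤s i<)

incoming : ℕ → ℕ → List (ℕ × ℕ)
incoming s zero = []
incoming s (suc t) = link (s + t) ∷ []

outgoing : ℕ → ℕ → List (ℕ × ℕ)
outgoing v zero = []
outgoing v (suc u) = link v ∷ []

-- the vertex s + t of segment s (t + suc u) together with its incident edges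
star : ℕ → ℕ → ℕ → Graph
star s t u = graph (s + t ∷ []) (incoming s t ++ outgoing (s + t) u)

links-from : ∀ v u → map link (interval v u) ≡ outgoing v u ++ map link (interval (suc v) (pred u))
links-from v zero = refl
links-from v (suc u) = refl

segment-around-vertex : ∀ s t u →
  segment s (t + suc u) ≡ segment s t ⊕ star s t u ⊕ segment (suc (s + t)) u
segment-around-vertex s t u = cong₂ graph (interval-++ s t (suc u)) (links s t)
  where
    links : ∀ s t → map link (interval s (pred (t + suc u))) ≡
            map link (interval s (pred t)) ++ (incoming s t ++ outgoing (s + t) u) ++
            map link (interval (suc (s + t)) (pred u))
    links s zero rewrite +-identityʳ s = links-from s u
    links s (suc t) rewrite +-suc s t = begin
      map link (interval s (t + suc u))
        ≡⟨ cong (map link) (interval-++ s t (suc u)) ⟩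
      map link (interval s t ++ interval (s + t) (suc u))
        ≡⟨ map-++ link (interval s t) _ ⟩
      map link (interval s t) ++ link (s + t) ∷ map link (interval (suc (s + t)) u)
        ≡⟨ cong (λ es → map link (interval s t) ++ link (s + t) ∷ es) (links-from (suc (s + t)) u) ⟩
      map link (interval s t) ++ link (s + t) ∷ outgoing (suc (s + t)) u ++
        map link (interval (suc (suc (s + t))) (pred u)) ∎

segment-around-edge : ∀ s t u →
  segment s (suc t + suc u) ≡ segment s (suc t) ⊕ graph [] (link (s + t) ∷ []) ⊕ segment (s + suc t) (suc u)
segment-around-edge s t u = cong₂ graph (interval-++ s (suc t) (suc u)) links
  where
    links : map link (interval s (t + suc u)) ≡
            map link (interval s t) ++ link (s + t) ∷ map link (interval (s + suc t) u)
    links rewrite interval-++ s t (suc u) | +-suc s t = map-++ link (interval s t) _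

star-incident : ∀ s t u → All (λ e → T (incident (s + t) e)) (edges (star s t u))
star-incident s t u = All.++⁺ (fromIncoming t) (fromOutgoing u)
  where
    fromIncoming : ∀ t → All (λ e → T (incident (s + t) e)) (incoming s t)
    fromIncoming zero = []
    fromIncoming (suc t) = Equivalence.from T-∨ (inj₂ (≡⇒≡ᵇ _ _ (+-suc s t))) ∷ []
    fromOutgoing : ∀ u → All (λ e → T (incident (s + t) e)) (outgoing (s + t) u)
    fromOutgoing zero = []
    fromOutgoing (suc u) = Equivalence.from T-∨ (inj₁ (≡⇒≡ᵇ (s + t) _ refl)) ∷ []

deleteVertex-star : ∀ s t u → deleteVertex (star s t u) (s + t) ≡ graph [] []
deleteVertex-star s t u =
  cong₂ graph (filter-none (λ x → T? (not (x ≡ᵇ s + t))) {s + t ∷ []}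
                           (T⇒¬T-not (≡⇒≡ᵇ (s + t) _ refl) ∷ []))
              (filter-none _ (All.map T⇒¬T-not (star-incident s t u)))

degree-star : ∀ s t u → degree (star s t u) (s + t) ≡ 1 ⊓ t + 1 ⊓ u
degree-star s t u = begin
  length (filterᵇ (incident (s + t)) (incoming s t ++ outgoing (s + t) u))
    ≡⟨ cong length (filter-all _ (star-incident s t u)) ⟩
  length (incoming s t ++ outgoing (s + t) u)
    ≡⟨ length-++ (incoming s t) ⟩
  length (incoming s t) + length (outgoing (s + t) u)
    ≡⟨ cong₂ _+_ (length-incoming t) (length-outgoing u) ⟩
  1 ⊓ t + 1 ⊓ u ∎
  where
    length-incoming : ∀ t → length (incoming s t) ≡ 1 ⊓ t
    length-incoming zero = refl
    length-incoming (suc t) = refl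
    length-outgoing : ∀ u → length (outgoing (s + t) u) ≡ 1 ⊓ u
    length-outgoing zero = refl
    length-outgoing (suc u) = refl

module _ (s t u : ℕ) where
  private
    v = s + t
    left-avoids : AllLabels (_≢ v) (segment s t)
    left-avoids = AllLabels-map (<⇒≢ ∘ proj₂) (segment-labels s t)
    right-avoids : AllLabels (_≢ v) (segment (suc v) u)
    right-avoids = AllLabels-map (>⇒≢ ∘ proj₁) (segment-labels (suc v) u)

  deleteVertex-segment : deleteVertex (segment s (t + suc u)) v ≡ segment s t ⊕ segment (suc v) u
  deleteVertex-segment = begin
    deleteVertex (segment s (t + suc u)) v
      ≡⟨ cong (λ G → deleteVertex G v) (segment-around-vertex s t u) ⟩
    deleteVertex (segment s t ⊕ star s t u ⊕ segment (suc v) u) v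
      ≡⟨ deleteVertex-⊕ (segment s t) _ v ⟩
    deleteVertex (segment s t) v ⊕ deleteVertex (star s t u ⊕ segment (suc v) u) v
      ≡⟨ cong (deleteVertex (segment s t) v ⊕_) (deleteVertex-⊕ (star s t u) _ v) ⟩
    deleteVertex (segment s t) v ⊕ deleteVertex (star s t u) v ⊕ deleteVertex (segment (suc v) u) v
      ≡⟨ cong₂ _⊕_ (deleteVertex-avoid left-avoids)
                   (cong₂ _⊕_ (deleteVertex-star s t u) (deleteVertex-avoid right-avoids)) ⟩
    segment s t ⊕ graph [] [] ⊕ segment (suc v) u ∎

  degree-segment : degree (segment s (t + suc u)) v ≡ 1 ⊓ t + 1 ⊓ u
  degree-segment = begin
    degree (segment s (t + suc u)) v
      ≡⟨ cong (λ G → degree G v) (segment-around-vertex s t u) ⟩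
    degree (segment s t ⊕ star s t u ⊕ segment (suc v) u) v
      ≡⟨ degree-⊕ (segment s t) (star s t u ⊕ segment (suc v) u) v ⟩
    degree (segment s t) v + degree (star s t u ⊕ segment (suc v) u) v
      ≡⟨ cong (degree (segment s t) v +_) (degree-⊕ (star s t u) (segment (suc v) u) v) ⟩
    degree (segment s t) v + (degree (star s t u) v + degree (segment (suc v) u) v)
      ≡⟨ cong₂ _+_ (degree-avoid {segment s t} left-avoids)
                   (cong₂ _+_ (degree-star s t u) (degree-avoid {segment (suc v) u} right-avoids)) ⟩
    1 ⊓ t + 1 ⊓ u + 0
      ≡⟨ +-identityʳ _ ⟩
    1 ⊓ t + 1 ⊓ u ∎

deleteEdge-segment : ∀ s t u →
  deleteEdge (segment s (suc t + suc u)) (link (s + t)) ≡ segment s (suc t) ⊕ segment (s + suc t) (suc u)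
deleteEdge-segment s t u = begin
  deleteEdge (segment s (suc t + suc u)) e
    ≡⟨ cong (λ G → deleteEdge G e) (segment-around-edge s t u) ⟩
  deleteEdge (segment s (suc t) ⊕ graph [] (e ∷ []) ⊕ segment (s + suc t) (suc u)) e
    ≡⟨ deleteEdge-⊕ (segment s (suc t)) _ e ⟩
  deleteEdge (segment s (suc t)) e ⊕ deleteEdge (graph [] (e ∷ []) ⊕ segment (s + suc t) (suc u)) e
    ≡⟨ cong (deleteEdge (segment s (suc t)) e ⊕_) (deleteEdge-⊕ (graph [] (e ∷ [])) _ e) ⟩
  deleteEdge (segment s (suc t)) e ⊕ deleteEdge (graph [] (e ∷ [])) e ⊕
    deleteEdge (segment (s + suc t) (suc u)) e
    ≡⟨ cong₂ _⊕_
         (deleteEdge-avoid {segment s (suc t)} (All.map⁺ (All.map (<⇒≢ ∘ proj₂) (interval-bounds s t))))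
         (cong₂ _⊕_ (cong (graph []) (filter-none (λ f → T? (not (sameEdge e f))) (T⇒¬T-not sameEdge-refl ∷ [])))
                    (deleteEdge-avoid {segment (s + suc t) (suc u)}
                       (All.map⁺ (All.map (>⇒≢ ∘ after) (interval-bounds (s + suc t) u))))) ⟩
  segment s (suc t) ⊕ graph [] [] ⊕ segment (s + suc t) (suc u) ∎
  where
    e = link (s + t)
    sameEdge-refl : T (sameEdge e e)
    sameEdge-refl = Equivalence.from T-∧ (≡⇒≡ᵇ (s + t) _ refl , ≡⇒≡ᵇ (suc (s + t)) _ refl)
    after : ∀ {i} → s + suc t ≤ i × i < s + suc t + u → s + t < i
    after {i} (le , _) = subst (_≤ i) (+-suc s t) le

segment-noIsolated : ∀ s l → 2 ≤ l → ¬ T (hasIsolated (segment s l))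
segment-noIsolated s l 2≤l =
  ¬T-any _ (interval s l) (All.map (λ (t , u , l≡ , x≡) → notIsolated t u l≡ x≡) (interval-positions s l))
  where
    positive : ∀ t u → 2 ≤ t + suc u → ¬ T (1 ⊓ t + 1 ⊓ u ≡ᵇ 0)
    positive zero zero (s≤s ())
    positive zero (suc u) _ ()
    positive (suc t) u _ ()
    notIsolated : ∀ t u {x} → l ≡ t + suc u → x ≡ s + t → ¬ T (degree (segment s l) x ≡ᵇ 0)
    notIsolated t u refl refl rewrite degree-segment s t u = positive t u 2≤l

-- A position reached from a path: a disjoint union of paths, each given by its first
-- vertex and its number of vertices.
Segments : Set
Segments = List (ℕ × ℕ)

linearForest : Segments → Graph
linearForest [] = graph [] []
linearForest ((s , l) ∷ ss) = segment s l ⊕ linearForest ss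

Nontrivial : Segments → Set
Nontrivial = All (λ (_ , l) → 2 ≤ l)

nontrivial-at : ∀ pre s l post → Nontrivial (pre ++ (s , l) ∷ post) → 2 ≤ l
nontrivial-at pre s l post nt with 2≤l ∷ _ ← All.++⁻ʳ pre nt = 2≤l

nontrivial-refine : ∀ pre x post s₁ l₁ s₂ l₂ → Nontrivial (pre ++ x ∷ post) →
  2 ≤ l₁ → 2 ≤ l₂ → Nontrivial (pre ++ (s₁ , l₁) ∷ (s₂ , l₂) ∷ post)
nontrivial-refine pre x post s₁ l₁ s₂ l₂ nt 2≤l₁ 2≤l₂ with All.++⁻ pre nt
... | before , _ ∷ after = All.++⁺ before (2≤l₁ ∷ 2≤l₂ ∷ after)

SeparatedFrom : ℕ → Segments → Set
SeparatedFrom b [] = ⊤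
SeparatedFrom b ((s , l) ∷ ss) = b ≤ s × SeparatedFrom (s + l) ss

linearForest-++ : ∀ xs ys → linearForest (xs ++ ys) ≡ linearForest xs ⊕ linearForest ys
linearForest-++ [] ys = refl
linearForest-++ ((s , l) ∷ xs) ys =
  trans (cong (segment s l ⊕_) (linearForest-++ xs ys)) (sym (⊕-assoc (segment s l) _ _))

linearForest-noIsolated : ∀ ss → Nontrivial ss → ¬ T (hasIsolated (linearForest ss))
linearForest-noIsolated [] [] ()
linearForest-noIsolated ((s , l) ∷ ss) (2≤l ∷ nt) =
  noIsolated-⊕ {segment s l} (segment-noIsolated s l 2≤l) (linearForest-noIsolated ss nt)

separatedFrom-labels : ∀ b ss → SeparatedFrom b ss → AllLabels (b ≤_) (linearForest ss)
separatedFrom-labels b [] _ = [] , []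
separatedFrom-labels b ((s , l) ∷ ss) (b≤s , sep) =
  AllLabels-⊕ (AllLabels-map (≤-trans b≤s ∘ proj₁) (segment-labels s l))
              (AllLabels-map (≤-trans (≤-trans b≤s (m≤m+n s l))) (separatedFrom-labels (s + l) ss sep))

separatedFrom-split : ∀ b pre s l post → SeparatedFrom b (pre ++ (s , l) ∷ post) →
  b ≤ s × AllLabels (_< s) (linearForest pre) × SeparatedFrom (s + l) post
separatedFrom-split b [] s l post (b≤s , sep) = b≤s , ([] , []) , sep
separatedFrom-split b ((s′ , l′) ∷ pre) s l post (b≤s′ , sep)
  with end≤s , labels , sep′ ← separatedFrom-split (s′ + l′) pre s l post sep =
  ≤-trans b≤s′ (≤-trans (m≤m+n s′ l′) end≤s) ,
  AllLabels-⊕ (AllLabels-map (λ (_ , x<) → <-≤-trans x< end≤s) (segment-labels s′ l′)) labels ,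
  sep′

separatedFrom-refine : ∀ {b} pre s l post s₁ l₁ s₂ l₂ → SeparatedFrom b (pre ++ (s , l) ∷ post) →
  s ≤ s₁ → s₁ + l₁ ≤ s₂ → s₂ + l₂ ≡ s + l →
  SeparatedFrom b (pre ++ (s₁ , l₁) ∷ (s₂ , l₂) ∷ post)
separatedFrom-refine [] s l post s₁ l₁ s₂ l₂ (b≤s , sep) s≤s₁ gap end =
  ≤-trans b≤s s≤s₁ , gap , subst (λ e → SeparatedFrom e post) (sym end) sep
separatedFrom-refine ((s′ , l′) ∷ pre) s l post s₁ l₁ s₂ l₂ (b≤s′ , sep) s≤s₁ gap end =
  b≤s′ , separatedFrom-refine pre s l post s₁ l₁ s₂ l₂ sep s≤s₁ gap end

separatedFrom-deleteVertex : ∀ {b} pre s t u post → SeparatedFrom b (pre ++ (s , t + suc u) ∷ post) →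
  SeparatedFrom b (pre ++ (s , t) ∷ (suc (s + t) , u) ∷ post)
separatedFrom-deleteVertex pre s t u post sep =
  separatedFrom-refine pre s _ post s t (suc (s + t)) u sep ≤-refl (n≤1+n _)
    (trans (sym (+-suc (s + t) u)) (+-assoc s t (suc u)))

separatedFrom-deleteEdge : ∀ {b} pre s t u post → SeparatedFrom b (pre ++ (s , suc t + suc u) ∷ post) →
  SeparatedFrom b (pre ++ (s , suc t) ∷ (s + suc t , suc u) ∷ post)
separatedFrom-deleteEdge pre s t u post sep =
  separatedFrom-refine pre s _ post s (suc t) (s + suc t) (suc u) sep ≤-refl ≤-refl (+-assoc s (suc t) (suc u))

avoids-frame : ∀ b pre s l post → SeparatedFrom b (pre ++ (s , l) ∷ post) →
  ∀ {v} → s ≤ v → v < s + l →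
  AllLabels (_≢ v) (linearForest pre) × AllLabels (_≢ v) (linearForest post)
avoids-frame b pre s l post sep s≤v v<
  with _ , below , sep′ ← separatedFrom-split b pre s l post sep =
  AllLabels-map (λ x<s → <⇒≢ (<-≤-trans x<s s≤v)) below ,
  AllLabels-map (λ le → >⇒≢ (<-≤-trans v< le)) (separatedFrom-labels (s + l) post sep′)

linearForest-around : ∀ pre s l post →
  linearForest (pre ++ (s , l) ∷ post) ≡ linearForest pre ⊕ segment s l ⊕ linearForest post
linearForest-around pre s l post = linearForest-++ pre ((s , l) ∷ post)

linearForest-around₂ : ∀ pre s l s′ l′ post →
  linearForest (pre ++ (s , l) ∷ (s′ , l′) ∷ post) ≡
  linearForest pre ⊕ (segment s l ⊕ segment s′ l′) ⊕ linearForest post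
linearForest-around₂ pre s l s′ l′ post =
  trans (linearForest-++ pre _) (cong (linearForest pre ⊕_) (sym (⊕-assoc (segment s l) _ _)))

linearForest-local : ∀ (op : Graph → Graph) → (∀ G H → op (G ⊕ H) ≡ op G ⊕ op H) →
  ∀ pre s l post → op (linearForest pre) ≡ linearForest pre → op (linearForest post) ≡ linearForest post →
  op (linearForest (pre ++ (s , l) ∷ post)) ≡ linearForest pre ⊕ op (segment s l) ⊕ linearForest post
linearForest-local op op-⊕ pre s l post fix-pre fix-post = begin
  op (linearForest (pre ++ (s , l) ∷ post))
    ≡⟨ cong op (linearForest-around pre s l post) ⟩
  op (linearForest pre ⊕ segment s l ⊕ linearForest post)
    ≡⟨ op-⊕ (linearForest pre) _ ⟩
  op (linearForest pre) ⊕ op (segment s l ⊕ linearForest post)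
    ≡⟨ cong (op (linearForest pre) ⊕_) (op-⊕ (segment s l) _) ⟩
  op (linearForest pre) ⊕ op (segment s l) ⊕ op (linearForest post)
    ≡⟨ cong₂ (λ G H → G ⊕ op (segment s l) ⊕ H) fix-pre fix-post ⟩
  linearForest pre ⊕ op (segment s l) ⊕ linearForest post ∎

module _ {b : ℕ} (pre : Segments) (s t u : ℕ) (post : Segments) where
  private
    v = s + t

  deleteVertex-linearForest : SeparatedFrom b (pre ++ (s , t + suc u) ∷ post) →
    deleteVertex (linearForest (pre ++ (s , t + suc u) ∷ post)) v ≡
    linearForest (pre ++ (s , t) ∷ (suc v , u) ∷ post)
  deleteVertex-linearForest sep
    with avoid-pre , avoid-post ← avoids-frame b pre s (t + suc u) post sep (m≤m+n s t) (v<end s t u) = begin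
    deleteVertex (linearForest (pre ++ (s , t + suc u) ∷ post)) v
      ≡⟨ linearForest-local (λ G → deleteVertex G v) (λ G H → deleteVertex-⊕ G H v) pre s (t + suc u) post
           (deleteVertex-avoid avoid-pre) (deleteVertex-avoid avoid-post) ⟩
    linearForest pre ⊕ deleteVertex (segment s (t + suc u)) v ⊕ linearForest post
      ≡⟨ cong (λ G → linearForest pre ⊕ G ⊕ linearForest post) (deleteVertex-segment s t u) ⟩
    linearForest pre ⊕ (segment s t ⊕ segment (suc v) u) ⊕ linearForest post
      ≡⟨ linearForest-around₂ pre s t (suc v) u post ⟨
    linearForest (pre ++ (s , t) ∷ (suc v , u) ∷ post) ∎

  degree-linearForest : SeparatedFrom b (pre ++ (s , t + suc u) ∷ post) →
    degree (linearForest (pre ++ (s , t + suc u) ∷ post)) v ≡ 1 ⊓ t + 1 ⊓ u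
  degree-linearForest sep
    with avoid-pre , avoid-post ← avoids-frame b pre s (t + suc u) post sep (m≤m+n s t) (v<end s t u) = begin
    degree (linearForest (pre ++ (s , t + suc u) ∷ post)) v
      ≡⟨ cong (λ G → degree G v) (linearForest-around pre s (t + suc u) post) ⟩
    degree (linearForest pre ⊕ segment s (t + suc u) ⊕ linearForest post) v
      ≡⟨ degree-⊕ (linearForest pre) (segment s (t + suc u) ⊕ linearForest post) v ⟩
    degree (linearForest pre) v + degree (segment s (t + suc u) ⊕ linearForest post) v
      ≡⟨ cong (degree (linearForest pre) v +_) (degree-⊕ (segment s (t + suc u)) (linearForest post) v) ⟩
    degree (linearForest pre) v + (degree (segment s (t + suc u)) v + degree (linearForest post) v)
      ≡⟨ cong₂ _+_ (degree-avoid {linearForest pre} avoid-pre)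
                   (cong₂ _+_ (degree-segment s t u) (degree-avoid {linearForest post} avoid-post)) ⟩
    1 ⊓ t + 1 ⊓ u + 0
      ≡⟨ +-identityʳ _ ⟩
    1 ⊓ t + 1 ⊓ u ∎

deleteEdge-linearForest : ∀ {b} pre s t u post → SeparatedFrom b (pre ++ (s , suc t + suc u) ∷ post) →
  deleteEdge (linearForest (pre ++ (s , suc t + suc u) ∷ post)) (link (s + t)) ≡
  linearForest (pre ++ (s , suc t) ∷ (s + suc t , suc u) ∷ post)
deleteEdge-linearForest {b} pre s t u post sep
  with avoid-pre , avoid-post ← avoids-frame b pre s (suc t + suc u) post sep (m≤m+n s t)
                                  (+-monoʳ-< s (s≤s (m≤m+n t (suc u)))) = begin
  deleteEdge (linearForest (pre ++ (s , suc t + suc u) ∷ post)) e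
    ≡⟨ linearForest-local (λ G → deleteEdge G e) (λ G H → deleteEdge-⊕ G H e) pre s (suc t + suc u) post
         (deleteEdge-avoid (All.map proj₁ (proj₂ avoid-pre)))
         (deleteEdge-avoid (All.map proj₁ (proj₂ avoid-post))) ⟩
  linearForest pre ⊕ deleteEdge (segment s (suc t + suc u)) e ⊕ linearForest post
    ≡⟨ cong (λ G → linearForest pre ⊕ G ⊕ linearForest post) (deleteEdge-segment s t u) ⟩
  linearForest pre ⊕ (segment s (suc t) ⊕ segment (s + suc t) (suc u)) ⊕ linearForest post
    ≡⟨ linearForest-around₂ pre s (suc t) (s + suc t) (suc u) post ⟨
  linearForest (pre ++ (s , suc t) ∷ (s + suc t , suc u) ∷ post) ∎
  where e = link (s + t)

vertex-∈ : ∀ pre s t u post → s + t ∈ vertices (linearForest (pre ++ (s , t + suc u) ∷ post))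
vertex-∈ pre s t u post rewrite linearForest-around pre s (t + suc u) post | interval-++ s t (suc u) =
  ∈-++⁺ʳ (vertices (linearForest pre)) (∈-++⁺ˡ (∈-++⁺ʳ (interval s t) (here refl)))

link-∈ : ∀ pre s t u post → link (s + t) ∈ edges (linearForest (pre ++ (s , suc t + suc u) ∷ post))
link-∈ pre s t u post rewrite linearForest-around pre s (suc t + suc u) post | interval-++ s t (suc u) =
  ∈-++⁺ʳ (edges (linearForest pre)) (∈-++⁺ˡ (∈-map⁺ link (∈-++⁺ʳ (interval s t) (here refl))))

isolated-linearForest : ∀ {b} pre s post → SeparatedFrom b (pre ++ (s , 1) ∷ post) →
  T (hasIsolated (linearForest (pre ++ (s , 1) ∷ post)))
isolated-linearForest pre s post sep =
  any⁺ _ (lose (vertex-∈ pre s 0 0 post) (≡⇒≡ᵇ _ 0 (degree-linearForest pre s 0 0 post sep)))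

record VertexSite (ss : Segments) (v : ℕ) : Set where
  constructor vertexSite
  field
    pre post : Segments
    s t u : ℕ
    split : ss ≡ pre ++ (s , t + suc u) ∷ post
    position : v ≡ s + t

vertexSites : ∀ ss → All (VertexSite ss) (vertices (linearForest ss))
vertexSites [] = []
vertexSites ((s , l) ∷ ss) =
  All.++⁺ (All.map (λ (t , u , l≡ , x≡) → vertexSite [] ss s t u (cong (λ l → (s , l) ∷ ss) l≡) x≡)
                   (interval-positions s l))
          (All.map (λ (vertexSite pre post s′ t u split position) →
                      vertexSite ((s , l) ∷ pre) post s′ t u (cong ((s , l) ∷_) split) position)
                   (vertexSites ss))

-- The potential and Right's answers

weight : ℕ → ℤ
weight 0 = 0ℤ
weight 1 = 0ℤ
weight 2 = 0ℤ
weight 3 = 0ℤ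
weight 4 = 1ℤ
weight 5 = -1ℤ
weight 6 = -1ℤ
weight 7 = -1ℤ
weight 8 = 0ℤ
weight (suc (suc (suc (suc (suc (suc (suc (suc (suc l))))))))) = weight (suc (suc (suc (suc (suc (suc (suc l)))))))

potential : Segments → ℤ
potential [] = 0ℤ
potential ((_ , l) ∷ ss) = weight l ℤ.+ potential ss

potential-++ : ∀ xs ys → potential (xs ++ ys) ≡ potential xs ℤ.+ potential ys
potential-++ [] ys = sym (ℤ.+-identityˡ (potential ys))
potential-++ ((_ , l) ∷ xs) ys =
  trans (cong (λ x → weight l ℤ.+ x) (potential-++ xs ys)) (sym (ℤ.+-assoc (weight l) _ _))

weight-nonpos : ∀ l → l ≢ 4 → weight l ℤ.≤ 0ℤ
weight-nonpos 0 _ = ℤ.≤-refl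
weight-nonpos 1 _ = ℤ.≤-refl
weight-nonpos 2 _ = ℤ.≤-refl
weight-nonpos 3 _ = ℤ.≤-refl
weight-nonpos 4 l≢4 = ⊥-elim (l≢4 refl)
weight-nonpos 5 _ = -≤+
weight-nonpos 6 _ = -≤+
weight-nonpos 7 _ = -≤+
weight-nonpos 8 _ = ℤ.≤-refl
weight-nonpos (suc (suc (suc (suc (suc (suc (suc (suc (suc l))))))))) _ =
  weight-nonpos (suc (suc (suc (suc (suc (suc (suc l))))))) (λ ())

weight-bounded : ∀ l → -1ℤ ℤ.≤ weight l
weight-bounded 0 = -≤+
weight-bounded 1 = -≤+
weight-bounded 2 = -≤+
weight-bounded 3 = -≤+
weight-bounded 4 = -≤+
weight-bounded 5 = ℤ.≤-refl
weight-bounded 6 = ℤ.≤-refl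
weight-bounded 7 = ℤ.≤-refl
weight-bounded 8 = -≤+
weight-bounded (suc (suc (suc (suc (suc (suc (suc (suc (suc l))))))))) =
  weight-bounded (suc (suc (suc (suc (suc (suc (suc l)))))))

four-of-positive : ∀ ss → ¬ (potential ss ℤ.≤ 0ℤ) →
  Σ Segments λ pre → Σ ℕ λ s → Σ Segments λ post → ss ≡ pre ++ (s , 4) ∷ post
four-of-positive [] positive = ⊥-elim (positive ℤ.≤-refl)
four-of-positive ((s , l) ∷ ss) positive with l ℕ.≟ 4
... | yes refl = [] , s , ss , refl
... | no l≢4 with potential ss ℤ.≤? 0ℤ
...   | yes ss≤0 = ⊥-elim (positive (ℤ.+-mono-≤ (weight-nonpos l l≢4) ss≤0))
...   | no ss≰0 with pre , s₀ , post , refl ← four-of-positive ss ss≰0 = (s , l) ∷ pre , s₀ , post , refl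

-- Right's candidate answers after Left split a path of L vertices into pieces of m and n
-- vertices: cut a path of a ∈ {2, 4} vertices off the piece m, or, when the split raised the
-- potential by at least one and weight L < 0 guarantees a P₄ elsewhere, cut that P₄ in two.
cutAt : ℕ → ℕ → ℕ → ℕ → Bool
cutAt a L m n = (a + 2 ℕ.≤ᵇ m) ∧ (weight L ℤ.≤ᵇ weight n ℤ.+ (weight a ℤ.+ weight (m ∸ a)))

cuts : ℕ → ℕ → ℕ → Bool
cuts L m n = cutAt 2 L m n ∨ cutAt 4 L m n

cutsFour : ℕ → ℕ → ℕ → Bool
cutsFour L m n = (weight L ℤ.≤ᵇ -1ℤ) ∧ (weight L ℤ.+ 1ℤ ℤ.≤ᵇ weight m ℤ.+ weight n)

replies : ℕ → ℕ → ℕ → Bool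
replies L m n = cuts L m n ∨ cuts L n m ∨ cutsFour L m n

goodReply : ℕ → ℕ → Bool
goodReply m n = replies (m + suc n) m n

goodReply-comm : ∀ m n → goodReply m n ≡ goodReply n m
goodReply-comm m n = trans (replies-comm (m + suc n)) (cong (λ L → replies L n m) L-comm)
  where
    L-comm : m + suc n ≡ n + suc m
    L-comm = trans (+-suc m n) (trans (cong suc (+-comm m n)) (sym (+-suc n m)))
    replies-comm : ∀ L → replies L m n ≡ replies L n m
    replies-comm L = begin
      x ∨ (y ∨ z)      ≡⟨ ∨-assoc x y z ⟨
      (x ∨ y) ∨ z      ≡⟨ cong (_∨ z) (∨-comm x y) ⟩
      (y ∨ x) ∨ z      ≡⟨ ∨-assoc y x z ⟩
      y ∨ (x ∨ z)      ≡⟨ cong (λ w → y ∨ (x ∨ ((weight L ℤ.≤ᵇ -1ℤ) ∧ (weight L ℤ.+ 1ℤ ℤ.≤ᵇ w))))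
                             (ℤ.+-comm (weight m) (weight n)) ⟩
      replies L n m ∎
      where x = cuts L m n ; y = cuts L n m ; z = cutsFour L m n

-- By computation: weight (l + 2) reduces to weight l once l ≥ 7.
goodReply-shift : ∀ k n → goodReply (13 + k) n ≡ goodReply (11 + k) n
goodReply-shift k n = refl

goodReply-table : ∀ (i j : Fin 11) → T (goodReply (2 + toℕ i) (2 + toℕ j))
goodReply-table = from-yes decision
  where
    decision : Dec (∀ (i j : Fin 11) → T (goodReply (2 + toℕ i) (2 + toℕ j)))
    decision = all? λ i → all? λ j → T? (goodReply (2 + toℕ i) (2 + toℕ j))

eventually-periodic-rec : ∀ (P : ℕ → Set) k → (∀ n → n < 2 + k → P n) →
  (∀ n → P (k + n) → P (2 + k + n)) → ∀ n → P n
eventually-periodic-rec P k base step = <-rec P go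
  where
    go : ∀ n → (∀ {m} → m < n → P m) → P n
    go n rec with n ℕ.<? 2 + k
    ... | yes n< = base n n<
    ... | no n≮ with m , refl ← m≤n⇒∃[o]m+o≡n (≮⇒≥ n≮) =
      step m (rec (m<n⇒m<1+n (n<1+n (k + m))))

goodReply-holds : ∀ m n → 2 ≤ m → 2 ≤ n → T (goodReply m n)
goodReply-holds (suc (suc t)) (suc (suc u)) (s≤s (s≤s _)) (s≤s (s≤s _)) = shifted t u
  where
    small : ∀ t u → t < 11 → u < 11 → T (goodReply (2 + t) (2 + u))
    small t u t< u< = subst₂ (λ i j → T (goodReply (2 + i) (2 + j))) (toℕ-fromℕ< t<) (toℕ-fromℕ< u<)
                             (goodReply-table (fromℕ< t<) (fromℕ< u<))
    small-first : ∀ t → t < 11 → ∀ u → T (goodReply (2 + t) (2 + u))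
    small-first t t< = eventually-periodic-rec _ 9 (λ u → small t u t<) λ k h →
      subst T (goodReply-comm (13 + k) (2 + t))
        (subst T (sym (goodReply-shift k (2 + t))) (subst T (goodReply-comm (2 + t) (11 + k)) h))
    shifted : ∀ t u → T (goodReply (2 + t) (2 + u))
    shifted = eventually-periodic-rec (λ t → ∀ u → T (goodReply (2 + t) (2 + u))) 9 small-first
      λ k h u → subst T (sym (goodReply-shift k (2 + u))) (h u)

record Cut (L m n : ℕ) : Set where
  constructor cut
  field
    t u : ℕ
    1≤t : 1 ≤ t
    1≤u : 1 ≤ u
    pieces : suc t + suc u ≡ m
    gain : weight L ℤ.≤ weight n ℤ.+ (weight (suc t) ℤ.+ weight (suc u))

cutAt-sound : ∀ a L m n → 2 ≤ a → T (cutAt a L m n) → Cut L m n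
cutAt-sound (suc t) L m n (s≤s 1≤t) ok
  with fits , gain ← Equivalence.to T-∧ ok
  with k , refl ← m≤n⇒∃[o]m+o≡n (≤ᵇ⇒≤ (suc t + 2) m fits) =
  cut t (suc k) 1≤t (s≤s z≤n) (sym (+-assoc (suc t) 2 k))
      (subst (λ r → weight L ℤ.≤ weight n ℤ.+ (weight (suc t) ℤ.+ weight r)) rest (ℤ.≤ᵇ⇒≤ gain))
  where
    rest : suc t + 2 + k ∸ suc t ≡ 2 + k
    rest = trans (cong (_∸ suc t) (+-assoc (suc t) 2 k)) (m+n∸m≡n (suc t) (2 + k))

cuts-sound : ∀ L m n → T (cuts L m n) → Cut L m n
cuts-sound L m n = [ cutAt-sound 2 L m n (s≤s (s≤s z≤n)) , cutAt-sound 4 L m n (s≤s (s≤s z≤n)) ]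
                 ∘ Equivalence.to T-∨

cutsFour-sound : ∀ L m n → T (cutsFour L m n) →
  weight L ℤ.≤ -1ℤ × weight L ℤ.+ 1ℤ ℤ.≤ weight m ℤ.+ weight n
cutsFour-sound L m n ok with loss , gain ← Equivalence.to (T-∧ {weight L ℤ.≤ᵇ -1ℤ}) ok =
  ℤ.≤ᵇ⇒≤ loss , ℤ.≤ᵇ⇒≤ gain

-- Right deletes the edge link (s + t).
record SafeCut (ss : Segments) : Set where
  constructor safeCut
  field
    pre post : Segments
    s t u : ℕ
    1≤t : 1 ≤ t
    1≤u : 1 ≤ u
    split : ss ≡ pre ++ (s , suc t + suc u) ∷ post
    safe : 0ℤ ℤ.≤ potential (pre ++ (s , suc t) ∷ (s + suc t , suc u) ∷ post)

nonneg-by-gain : ∀ {X Y p q} → 0ℤ ℤ.≤ X → p ℤ.≤ q → Y ≡ X ℤ.+ (q ℤ.- p) → 0ℤ ℤ.≤ Y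
nonneg-by-gain 0≤X p≤q refl = ℤ.+-mono-≤ 0≤X (ℤ.i≤j⇒0≤j-i p≤q)

module _ (pre : Segments) (s m n : ℕ) (post : Segments)
         (φ : 0ℤ ℤ.≤ potential (pre ++ (s , m + suc n) ∷ post)) where
  private
    L = m + suc n
    rest = (suc (s + m) , n) ∷ post
    φ′ : 0ℤ ℤ.≤ potential pre ℤ.+ (weight L ℤ.+ potential post)
    φ′ = subst (0ℤ ℤ.≤_) (potential-++ pre _) φ

  cutFirst-safe : Cut L m n → SafeCut (pre ++ (s , m) ∷ rest)
  cutFirst-safe (cut t u 1≤t 1≤u refl gain) =
    safeCut pre rest s t u 1≤t 1≤u refl
      (subst (0ℤ ℤ.≤_) (sym (potential-++ pre _))
        (nonneg-by-gain φ′ gain (rearrange (potential pre) (potential post) (weight L)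
                                           (weight (suc t)) (weight (suc u)) (weight n))))
    where
      rearrange : ∀ P Q w a b c → P ℤ.+ (a ℤ.+ (b ℤ.+ (c ℤ.+ Q))) ≡
                  P ℤ.+ (w ℤ.+ Q) ℤ.+ (c ℤ.+ (a ℤ.+ b) ℤ.- w)
      rearrange = solve-∀

  cutSecond-safe : Cut L n m → SafeCut (pre ++ (s , m) ∷ rest)
  cutSecond-safe (cut t u 1≤t 1≤u refl gain) =
    safeCut (pre ++ (s , m) ∷ []) post (suc (s + m)) t u 1≤t 1≤u (sym (++-assoc pre _ _)) safe
    where
      rearrange : ∀ P Q w a b c → P ℤ.+ (c ℤ.+ 0ℤ) ℤ.+ (a ℤ.+ (b ℤ.+ Q)) ≡
                  P ℤ.+ (w ℤ.+ Q) ℤ.+ (c ℤ.+ (a ℤ.+ b) ℤ.- w)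
      rearrange = solve-∀
      safe : 0ℤ ℤ.≤ potential ((pre ++ (s , m) ∷ []) ++
                               (suc (s + m) , suc t) ∷ (suc (s + m) + suc t , suc u) ∷ post)
      safe = nonneg-by-gain φ′ gain
        (trans (potential-++ (pre ++ (s , m) ∷ []) _)
          (trans (cong (λ z → z ℤ.+ (weight (suc t) ℤ.+ (weight (suc u) ℤ.+ potential post)))
                       (potential-++ pre _))
            (rearrange (potential pre) (potential post) (weight L) (weight (suc t)) (weight (suc u)) (weight m))))

  cutFour-safe : T (cutsFour L m n) → SafeCut (pre ++ (s , m) ∷ rest)
  cutFour-safe ok with loss , gain ← cutsFour-sound L m n ok
                  with potential pre ℤ.≤? 0ℤ | potential post ℤ.≤? 0ℤ
  ... | yes pre≤0 | yes post≤0
    with () ← ℤ.≤-trans φ′ (ℤ.+-mono-≤ pre≤0 (ℤ.+-mono-≤ loss post≤0))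
  ... | no pre≰0 | _ with A , s₀ , B , refl ← four-of-positive pre pre≰0 =
    safeCut A (B ++ (s , m) ∷ rest) s₀ 1 1 (s≤s z≤n) (s≤s z≤n) (++-assoc A _ _) safe
    where
      rearrange : ∀ a b Q w x y → a ℤ.+ (0ℤ ℤ.+ (0ℤ ℤ.+ (b ℤ.+ (x ℤ.+ (y ℤ.+ Q))))) ≡
                  a ℤ.+ (1ℤ ℤ.+ b) ℤ.+ (w ℤ.+ Q) ℤ.+ (x ℤ.+ y ℤ.- (w ℤ.+ 1ℤ))
      rearrange = solve-∀
      safe : 0ℤ ℤ.≤ potential (A ++ (s₀ , 2) ∷ (s₀ + 2 , 2) ∷ B ++ (s , m) ∷ rest)
      safe = nonneg-by-gain
        (subst (λ x → 0ℤ ℤ.≤ x ℤ.+ (weight L ℤ.+ potential post)) (potential-++ A _) φ′) gain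
        (trans (potential-++ A _)
          (trans (cong (λ z → potential A ℤ.+ (0ℤ ℤ.+ (0ℤ ℤ.+ z))) (potential-++ B _))
            (rearrange (potential A) (potential B) (potential post) (weight L) (weight m) (weight n))))
  ... | yes _ | no post≰0 with A , s₀ , B , refl ← four-of-positive post post≰0 =
    safeCut (pre ++ (s , m) ∷ (suc (s + m) , n) ∷ A) B s₀ 1 1 (s≤s z≤n) (s≤s z≤n)
      (sym (++-assoc pre _ _)) safe
    where
      rearrange : ∀ P a b w x y → P ℤ.+ (x ℤ.+ (y ℤ.+ a)) ℤ.+ (0ℤ ℤ.+ (0ℤ ℤ.+ b)) ≡
                  P ℤ.+ (w ℤ.+ (a ℤ.+ (1ℤ ℤ.+ b))) ℤ.+ (x ℤ.+ y ℤ.- (w ℤ.+ 1ℤ))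
      rearrange = solve-∀
      safe : 0ℤ ℤ.≤ potential ((pre ++ (s , m) ∷ (suc (s + m) , n) ∷ A) ++ (s₀ , 2) ∷ (s₀ + 2 , 2) ∷ B)
      safe = nonneg-by-gain
        (subst (λ x → 0ℤ ℤ.≤ potential pre ℤ.+ (weight L ℤ.+ x)) (potential-++ A _) φ′) gain
        (trans (potential-++ (pre ++ (s , m) ∷ (suc (s + m) , n) ∷ A) _)
          (trans (cong (λ z → z ℤ.+ (0ℤ ℤ.+ (0ℤ ℤ.+ potential B))) (potential-++ pre _))
            (rearrange (potential pre) (potential A) (potential B) (weight L) (weight m) (weight n))))

  safeReply : 2 ≤ m → 2 ≤ n → SafeCut (pre ++ (s , m) ∷ rest)
  safeReply 2≤m 2≤n with Equivalence.to T-∨ (goodReply-holds m n 2≤m 2≤n)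
  ... | inj₁ first = cutFirst-safe (cuts-sound L m n first)
  ... | inj₂ others with Equivalence.to T-∨ others
  ...   | inj₁ second = cutSecond-safe (cuts-sound L n m second)
  ...   | inj₂ four = cutFour-safe four

-- Right's strategy

vertexCount : Segments → ℕ
vertexCount [] = 0
vertexCount ((_ , l) ∷ ss) = l + vertexCount ss

vertexCount-around : ∀ pre s l post →
  vertexCount (pre ++ (s , l) ∷ post) ≡ vertexCount pre + (l + vertexCount post)
vertexCount-around [] s l post = refl
vertexCount-around ((_ , l′) ∷ pre) s l post =
  trans (cong (l′ +_) (vertexCount-around pre s l post)) (sym (+-assoc l′ _ _))

-- Left is to move.  A Left move and Right's answer remove one vertex and use up two levels
-- of the fuel-bounded game tree, which is what the bound `fuel` accounts for.
record Safe (F : ℕ) (ss : Segments) : Set where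
  field
    separated : SeparatedFrom 0 ss
    nontrivial : Nontrivial ss
    nonneg : 0ℤ ℤ.≤ potential ss
    fuel : vertexCount ss + vertexCount ss ≤ suc F

vertexCount-deleteVertex : ∀ pre s t u post →
  suc (vertexCount (pre ++ (s , t) ∷ (suc (s + t) , u) ∷ post)) ≡ vertexCount (pre ++ (s , t + suc u) ∷ post)
vertexCount-deleteVertex pre s t u post = begin
  suc (vertexCount (pre ++ (s , t) ∷ (suc (s + t) , u) ∷ post))
    ≡⟨ cong suc (vertexCount-around pre s t _) ⟩
  suc (vertexCount pre + (t + (u + vertexCount post)))
    ≡⟨ +-suc (vertexCount pre) _ ⟨
  vertexCount pre + suc (t + (u + vertexCount post))
    ≡⟨ cong (vertexCount pre +_) (trans (+-assoc t (suc u) _) (+-suc t _)) ⟨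
  vertexCount pre + (t + suc u + vertexCount post)
    ≡⟨ vertexCount-around pre s (t + suc u) post ⟨
  vertexCount (pre ++ (s , t + suc u) ∷ post) ∎

vertexCount-deleteEdge : ∀ pre s t u post →
  vertexCount (pre ++ (s , suc t) ∷ (s + suc t , suc u) ∷ post) ≡
  vertexCount (pre ++ (s , suc t + suc u) ∷ post)
vertexCount-deleteEdge pre s t u post = begin
  vertexCount (pre ++ (s , suc t) ∷ (s + suc t , suc u) ∷ post)
    ≡⟨ vertexCount-around pre s (suc t) _ ⟩
  vertexCount pre + (suc t + (suc u + vertexCount post))
    ≡⟨ cong (vertexCount pre +_) (+-assoc (suc t) (suc u) _) ⟨
  vertexCount pre + (suc t + suc u + vertexCount post)
    ≡⟨ vertexCount-around pre s (suc t + suc u) post ⟨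
  vertexCount (pre ++ (s , suc t + suc u) ∷ post) ∎

length≤vertexCount : ∀ pre s l post → l ≤ vertexCount (pre ++ (s , l) ∷ post)
length≤vertexCount pre s l post =
  subst (l ≤_) (sym (vertexCount-around pre s l post)) (≤-trans (m≤m+n l _) (m≤n+m _ (vertexCount pre)))

two≤vertexCount : ∀ pre s t l post → 2 ≤ vertexCount (pre ++ (s , suc (suc t) + l) ∷ post)
two≤vertexCount pre s t l post =
  ≤-trans (s≤s (s≤s z≤n)) (≤-trans (m≤m+n _ l) (length≤vertexCount pre s _ post))

mutual
  rightWins : ∀ F ss → Safe F ss → AtMostNonNeg (gameWithFuel F (linearForest ss))
  rightWins zero ss _ = zero-atMostNonNeg
  rightWins (suc F) ss safe =
    atMostNonNeg-intro (All.map⁺ (All-leftMoves (λ G → Any AtMostNonNeg (rightOptions (gameWithFuel F G)))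
      (linearForest ss) (All.map (λ site → leftMove-answered F ss site safe) (vertexSites ss))))

  safeCut-wins : ∀ F ss → SeparatedFrom 0 ss → Nontrivial ss → SafeCut ss →
    vertexCount ss + vertexCount ss ≤ suc F →
    Any AtMostNonNeg (map (gameWithFuel F) (rightMoves (linearForest ss)))
  safeCut-wins F _ sep nt (safeCut pre post s t u 1≤t 1≤u refl φ) fuel =
    Any.map⁺ (Any-rightMoves (AtMostNonNeg ∘ gameWithFuel F) _ (link (s + t))
      (linearForest-noIsolated _ nt) (link-∈ pre s t u post)
      (subst (λ G → ¬ T (hasIsolated G)) (sym afterCut) (linearForest-noIsolated _ nt′))
      (subst (AtMostNonNeg ∘ gameWithFuel F) (sym afterCut) (rightWins F _ safe′)))
    where
      afterCut = deleteEdge-linearForest pre s t u post sep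
      nt′ = nontrivial-refine pre _ post s (suc t) (s + suc t) (suc u) nt (s≤s 1≤t) (s≤s 1≤u)
      safe′ : Safe F (pre ++ (s , suc t) ∷ (s + suc t , suc u) ∷ post)
      safe′ = record
        { separated = separatedFrom-deleteEdge pre s t u post sep
        ; nontrivial = nt′
        ; nonneg = φ
        ; fuel = subst (λ c → c + c ≤ suc F) (sym (vertexCount-deleteEdge pre s t u post)) fuel
        }

  leftMove-answered : ∀ F ss {v} → VertexSite ss v → Safe (suc F) ss →
    T (not (isLeaf (linearForest ss) v)) → T (not (hasIsolated (deleteVertex (linearForest ss) v))) →
    Any AtMostNonNeg (rightOptions (gameWithFuel F (deleteVertex (linearForest ss) v)))
  leftMove-answered F _ (vertexSite pre post s zero zero refl refl) safe _ _
    with s≤s () ← nontrivial-at pre s 1 post (Safe.nontrivial safe)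
  leftMove-answered F _ (vertexSite pre post s zero (suc u) refl refl) safe notLeaf _ =
    ⊥-elim (T-not⇒¬T notLeaf (≡⇒≡ᵇ _ 1 (degree-linearForest pre s 0 (suc u) post (Safe.separated safe))))
  leftMove-answered F _ (vertexSite pre post s (suc t) zero refl refl) safe notLeaf _ =
    ⊥-elim (T-not⇒¬T notLeaf (≡⇒≡ᵇ _ 1 (degree-linearForest pre s (suc t) 0 post (Safe.separated safe))))
  leftMove-answered F _ (vertexSite pre post s 1 (suc u) refl refl) safe _ legal =
    ⊥-elim (T-not⇒¬T legal (subst (T ∘ hasIsolated) (sym (deleteVertex-linearForest pre s 1 (suc u) post sep))
      (isolated-linearForest pre s _ (separatedFrom-deleteVertex pre s 1 (suc u) post sep))))
    where sep = Safe.separated safe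
  leftMove-answered F _ (vertexSite pre post s (suc (suc t)) 1 refl refl) safe _ legal =
    ⊥-elim (T-not⇒¬T legal (subst (T ∘ hasIsolated) (sym (deleteVertex-linearForest pre s _ 1 post sep))
      (subst (T ∘ hasIsolated ∘ linearForest) (++-assoc pre _ _)
        (isolated-linearForest (pre ++ (s , suc (suc t)) ∷ []) _ post
          (subst (SeparatedFrom 0) (sym (++-assoc pre _ _)) (separatedFrom-deleteVertex pre s _ 1 post sep))))))
    where sep = Safe.separated safe
  leftMove-answered zero _ (vertexSite pre post s (suc (suc t)) (suc (suc u)) refl refl) safe _ _
    with s≤s (s≤s ()) ← ≤-trans (+-mono-≤ (two≤vertexCount pre s t _ post) (two≤vertexCount pre s t _ post))
                                (Safe.fuel safe)
  leftMove-answered (suc F) _ (vertexSite pre post s (suc (suc t)) (suc (suc u)) refl refl) safe _ _ =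
    subst (λ G → Any AtMostNonNeg (map (gameWithFuel F) (rightMoves G)))
      (sym (deleteVertex-linearForest pre s _ _ post sep))
      (safeCut-wins F _ (separatedFrom-deleteVertex pre s _ _ post sep)
        (nontrivial-refine pre _ post s _ _ _ (Safe.nontrivial safe) (s≤s (s≤s z≤n)) (s≤s (s≤s z≤n)))
        (safeReply pre s _ _ post (Safe.nonneg safe) (s≤s (s≤s z≤n)) (s≤s (s≤s z≤n)))
        fuel)
    where
      sep = Safe.separated safe
      fuel = halve (subst (λ c → c + c ≤ suc (suc (suc F))) (sym (vertexCount-deleteVertex pre s _ _ post))
                          (Safe.fuel safe))
        where
          halve : ∀ {c} → suc c + suc c ≤ suc (suc (suc F)) → c + c ≤ suc F
          halve {c} le = ≤-pred (≤-pred (subst (_≤ suc (suc (suc F))) (cong suc (+-suc c c)) le))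

applyUpTo-interval : ∀ (f : ℕ → ℕ) s n → (∀ i → f i ≡ s + i) → applyUpTo f n ≡ interval s n
applyUpTo-interval f s zero _ = refl
applyUpTo-interval f s (suc n) f≗ =
  cong₂ _∷_ (trans (f≗ 0) (+-identityʳ s))
            (applyUpTo-interval (f ∘ suc) (suc s) n (λ i → trans (f≗ (suc i)) (+-suc s i)))

path-linearForest : ∀ n → path n ≡ linearForest ((0 , n) ∷ [])
path-linearForest n =
  cong₂ graph (trans (upTo-interval n) (sym (++-identityʳ _))) (trans (edges-interval n) (sym (++-identityʳ _)))
  where
    upTo-interval : ∀ n → upTo n ≡ interval 0 n
    upTo-interval n = applyUpTo-interval (λ i → i) 0 n (λ _ → refl)
    edges-interval : ∀ n → pathEdges n ≡ map link (interval 0 (pred n))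
    edges-interval zero = refl
    edges-interval (suc zero) = refl
    edges-interval (suc (suc n)) = cong (map link) (upTo-interval (suc n))

firstCut : ∀ k → SafeCut ((0 , 4 + k) ∷ [])
firstCut zero = safeCut [] [] 0 1 1 (s≤s z≤n) (s≤s z≤n) refl ℤ.≤-refl
firstCut (suc zero) = safeCut [] [] 0 1 2 (s≤s z≤n) (s≤s z≤n) refl ℤ.≤-refl
firstCut (suc (suc k)) = safeCut [] [] 0 3 (suc k) (s≤s z≤n) (s≤s z≤n) refl
  (ℤ.+-monoʳ-≤ 1ℤ (ℤ.+-monoˡ-≤ 0ℤ (weight-bounded (suc (suc k)))))

path-rightOption : ∀ k → Any AtMostNonNeg (rightOptions (forbiddenLeafGame (path (4 + k))))
path-rightOption k =
  subst (λ G → Any AtMostNonNeg (map (gameWithFuel F) (rightMoves G))) (sym (path-linearForest (4 + k)))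
    (safeCut-wins F _ (z≤n , _) (s≤s (s≤s z≤n) ∷ []) (firstCut k) fuel)
  where
    F = length (upTo (4 + k)) + length (pathEdges (4 + k))
    fuel : 4 + k + 0 + (4 + k + 0) ≤ suc F
    fuel = ≤-reflexive (begin
      4 + k + 0 + (4 + k + 0)  ≡⟨ cong₂ _+_ (+-identityʳ (4 + k)) (+-identityʳ (4 + k)) ⟩
      4 + k + (4 + k)          ≡⟨ +-suc (4 + k) (3 + k) ⟩
      suc (4 + k + (3 + k))    ≡⟨ cong₂ (λ a b → suc (a + b)) (length-upTo (4 + k)) lengthEdges ⟨
      suc F                    ∎)
      where
        lengthEdges : length (pathEdges (4 + k)) ≡ 3 + k
        lengthEdges = trans (length-map link (upTo (3 + k))) (length-upTo (3 + k))

positive-≰-path : ∀ n → 0 < n → ∀ {D} → NonNeg D → HasNonNegLeftOption D →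
  ¬ (D ≤G forbiddenLeafGame (path n))
-- P₁, P₂ and P₃ admit no legal move, so their game computes to 0.
positive-≰-path 1 _ {D} _ positive = ≰-zero {D} positive
positive-≰-path 2 _ {D} _ positive = ≰-zero {D} positive
positive-≰-path 3 _ {D} _ positive = ≰-zero {D} positive
positive-≰-path (suc (suc (suc (suc k)))) _ nonneg _ = ≰-of-rightOption nonneg (path-rightOption k)

corollary3p10 : (n : ℕ) → 0 < n →
    (¬ Σ ℕ (λ m → (0 < m) × (forbiddenLeafGame (path n) ≈G intGame m)))
    × (¬ Σ ℕ (λ m → Σ ℕ (λ k → (0 < m) × (forbiddenLeafGame (path n) ≈G dyadicGame m k))))
corollary3p10 n 0<n = notInteger , notDyadic
  where
    notInteger : ¬ Σ ℕ (λ m → (0 < m) × (forbiddenLeafGame (path n) ≈G intGame m))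
    notInteger (suc m , _ , _ , m≤G) =
      positive-≰-path n 0<n (nonNeg-intGame (suc m)) (hasNonNegLeftOption-intGame m) m≤G
    notDyadic : ¬ Σ ℕ (λ m → Σ ℕ (λ k → (0 < m) × (forbiddenLeafGame (path n) ≈G dyadicGame m k)))
    notDyadic (m , k , 0<m , _ , d≤G) =
      positive-≰-path n 0<n (nonNeg-dyadicGame m k) (hasNonNegLeftOption-dyadicGame m k 0<m) d≤G
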